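{- The compactness theorem fails for the logic $L([1],[\omega],\mathtt u,\mathtt U)$: there exists a theory that is finitely satisfiable but not satisfiable.
   Context: Let $Var=\{p_n : n\in\omega\}$ be a set of propositional variables. Formulas of $L([1],[\omega],\mathtt u,\mathtt U)$ are built from $Var$ using the unary connectives $\lnot$, $[1]$, $[\omega]$ and the binary connectives $\land$, $\mathtt u$, $\mathtt U$; $\lor,\to,\leftrightarrow$ are defined as usual, and $[a]^0\phi=\phi$, $[a]^{n+1}\phi=[a][a]^n\phi$ for $a\in\{1,\omega\}$. A theory is a nonempty set of formulas. Time instants are pairs $\mathbf t=\langle t_1,t_2\rangle\in\omega\times\omega$, ordered lexicographically ($\langle i,j\rangle\leqslant\langle k,l\rangle$ iff $i<k$, or $i=k$ and $j\leqslant l$). A model is a function $\xi:\omega\times\omega\times Var\to\{0,1\}$. Satisfaction $\xi\models_{\mathbf r}\phi$ is defined by: $\xi\models_{\mathbf r}p$ iff $\xi(r_1,r_2,p)=1$; $\lnot,\land$ classically; $\xi\models_{\mathbf r}[1]\phi$ iff $\xi\models_{\langle r_1,r_2+1\rangle}\phi$; $\xi\models_{\mathbf r}[\omega]\phi$ iff $\xi\models_{\langle r_1+1,0\rangle}\phi$; $\xi\models_{\mathbf r}\phi\,\mathtt u\,\psi$ iff there is $k\in\omega$ with $\xi\models_{\langle r_1,r_2+k\rangle}\psi$ and $\xi\models_{\langle r_1,r_2+i\rangle}\phi$ for all $0\leqslant i<k$; $\xi\models_{\mathbf r}\phi\,\mathtt U\,\psi$ iff there is $\mathbf s\geqslant\mathbf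 r$ with $\xi\models_{\mathbf s}\psi$ and $\xi\models_{\mathbf t}\phi$ for all $\mathbf r\leqslant\mathbf t<\mathbf s$. A theory $T$ is satisfiable iff there exist a model $\xi$ and a time instant $\mathbf t$ with $\xi\models_{\mathbf t}\phi$ for all $\phi\in T$; it is finitely satisfiable iff every finite subset of $T$ is satisfiable. -}

module Defs where

open import Data.Nat using (ℕ; zero; suc; _+_; _<_; _≤_)
open import Data.Bool using (Bool; true)
open import Data.Product using (Σ; _×_; ∃; ∃-syntax; _,_; proj₁; proj₂)
open import Data.Sum using (_⊎_)
open import Data.Empty using (⊥)
open import Data.List using (List)
open import Data.List.Membership.Propositional using (_∈_)
open import Relation.Binary.PropositionalEquality using (_≡_)
open import Relation.Nullary using (¬_)

Var : Set
Var = ℕ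

data Formula : Set where
  var   : Var → Formula
  ¬'_   : Formula → Formula
  _∧'_  : Formula → Formula → Formula
  [1]_  : Formula → Formula
  [ω]_  : Formula → Formula
  _u_   : Formula → Formula → Formula
  _U_   : Formula → Formula → Formula

Time : Set
Time = ℕ × ℕ

_≤ₜ_ : Time → Time → Set
(i , j) ≤ₜ (k , l) = (i < k) ⊎ ((i ≡ k) × (j ≤ l))

_<ₜ_ : Time → Time → Set
r <ₜ s = (r ≤ₜ s) × ¬ (r ≡ s)

Model : Set
Model = ℕ → ℕ → Var → Bool

_⊨[_]_ : Model → Time → Formula → Set
ξ ⊨[ (r₁ , r₂) ] var p = ξ r₁ r₂ p ≡ true
ξ ⊨[ r ] (¬' φ) = ¬ (ξ ⊨[ r ] φ)
ξ ⊨[ r ] (φ ∧' ψ) = (ξ ⊨[ r ] φ) × (ξ ⊨[ r ] ψ)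
ξ ⊨[ (r₁ , r₂) ] ([1] φ) = ξ ⊨[ (r₁ , suc r₂) ] φ
ξ ⊨[ (r₁ , r₂) ] ([ω] φ) = ξ ⊨[ (suc r₁ , 0) ] φ
ξ ⊨[ (r₁ , r₂) ] (φ u ψ) =
  ∃[ k ] ((ξ ⊨[ (r₁ , r₂ + k) ] ψ) × (∀ i → i < k → ξ ⊨[ (r₁ , r₂ + i) ] φ))
ξ ⊨[ r ] (φ U ψ) =
  ∃[ s ] ((r ≤ₜ s) × (ξ ⊨[ s ] ψ) × (∀ t → r ≤ₜ t → t <ₜ s → ξ ⊨[ t ] φ))

record Theory : Set₁ where
  field
    _∋_      : Formula → Set
    nonempty : ∃[ φ ] (_∋_ φ)
open Theory public

SatisfiableSet : (Formula → Set) → Set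
SatisfiableSet S = ∃[ ξ ] ∃[ t ] (∀ φ → S φ → ξ ⊨[ t ] φ)

Satisfiable : Theory → Set
Satisfiable T = SatisfiableSet (T ∋_)

FinitelySatisfiable : Theory → Set
FinitelySatisfiable T =
  (Δ : List Formula) → (∀ φ → φ ∈ Δ → T ∋ φ) → SatisfiableSet (λ φ → φ ∈ Δ)

-- The theory {¬p u p} ∪ {[1]ⁿ ¬p : n ∈ ω} asserts that p holds at some position
-- r₂ + k of the current block, but at no position r₂ + n.  A finite part forbids p
-- at only finitely many positions, so p may be placed beyond all of them.
module Submission where

open import Defs
open import Data.Nat using (ℕ; zero; suc; _+_; _<_; _≤_; _≡ᵇ_; s≤s)
open import Data.Nat.Properties using (+-identityʳ; +-suc; <-irrefl; ≡ᵇ⇒≡; ≡⇒≡ᵇ)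
open import Data.Bool.Properties using (T-≡)
open import Data.Product using (_×_; ∃-syntax; _,_)
open import Data.List using (List; map)
open import Data.List.Extrema.Nat using (max; xs≤max)
open import Data.List.Membership.Propositional using (_∈_)
open import Data.List.Membership.Propositional.Properties using (∈-map⁺)
open import Data.List.Relation.Unary.All as All using ()
open import Function using (id)
open import Function.Bundles using (Equivalence)
open import Relation.Binary.PropositionalEquality using (_≡_; refl; sym; trans; cong; subst)
open import Relation.Nullary using (¬_)

[1]^_ : ℕ → Formula → Formula
([1]^ zero) φ = φ
([1]^ suc n) φ = [1] (([1]^ n) φ)

⊨-[1]^ : ∀ (ξ : Model) n φ a b → ξ ⊨[ a , b ] ([1]^ n) φ ≡ ξ ⊨[ a , b + n ] φ
⊨-[1]^ ξ zero φ a b = cong (λ c → ξ ⊨[ a , c ] φ) (sym (+-identityʳ b))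
⊨-[1]^ ξ (suc n) φ a b =
  trans (⊨-[1]^ ξ n φ a (suc b)) (cong (λ c → ξ ⊨[ a , c ] φ) (sym (+-suc b n)))

leading[1]s : Formula → ℕ
leading[1]s ([1] φ) = suc (leading[1]s φ)
leading[1]s _ = 0

leading[1]s-[1]^¬ : ∀ n φ → leading[1]s (([1]^ n) (¬' φ)) ≡ n
leading[1]s-[1]^¬ zero φ = refl
leading[1]s-[1]^¬ (suc n) φ = cong suc (leading[1]s-[1]^¬ n φ)

leading[1]s-bound : List Formula → ℕ
leading[1]s-bound Δ = max 0 (map leading[1]s Δ)

leading[1]s-≤-bound : ∀ {φ Δ} → φ ∈ Δ → leading[1]s φ ≤ leading[1]s-bound Δ
leading[1]s-≤-bound φ∈Δ = All.lookup (xs≤max 0 _) (∈-map⁺ leading[1]s φ∈Δ)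

p : Formula
p = var 0

data Member : Formula → Set where
  eventually-p : Member ((¬' p) u p)
  ¬p-after     : ∀ n → Member (([1]^ n) (¬' p))

theory : Theory
theory = record { _∋_ = Member ; nonempty = _ , eventually-p }

pOnlyAt : ℕ → Model
pOnlyAt N _ b _ = b ≡ᵇ N

pOnlyAt-⊨p : ∀ N a → pOnlyAt N ⊨[ a , N ] p
pOnlyAt-⊨p N a = Equivalence.to T-≡ (≡⇒≡ᵇ N N refl)

pOnlyAt-⊨p⇒≡ : ∀ {N a b} → pOnlyAt N ⊨[ a , b ] p → b ≡ N
pOnlyAt-⊨p⇒≡ {N} {b = b} pb = ≡ᵇ⇒≡ b N (Equivalence.from T-≡ pb)

pOnlyAt-⊨ : ∀ {N φ} → Member φ → leading[1]s φ < N → pOnlyAt N ⊨[ 0 , 0 ] φ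
pOnlyAt-⊨ {N} eventually-p _ =
  N , pOnlyAt-⊨p N 0 , λ i i<N pi → <-irrefl (pOnlyAt-⊨p⇒≡ {a = 0} pi) i<N
pOnlyAt-⊨ {N} (¬p-after n) n<N =
  subst id (sym (⊨-[1]^ (pOnlyAt N) n (¬' p) 0 0)) λ pn →
    <-irrefl (pOnlyAt-⊨p⇒≡ {a = 0} pn) (subst (_< N) (leading[1]s-[1]^¬ n p) n<N)

finitelySatisfiable : FinitelySatisfiable theory
finitelySatisfiable Δ Δ⊆theory = pOnlyAt (suc (leading[1]s-bound Δ)) , (0 , 0) ,
  λ φ φ∈Δ → pOnlyAt-⊨ (Δ⊆theory φ φ∈Δ) (s≤s (leading[1]s-≤-bound φ∈Δ))

unsatisfiable : ¬ Satisfiable theory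
unsatisfiable (ξ , (a , b) , ξ⊨theory) =
  let (k , p-at-k , _) = ξ⊨theory _ eventually-p
  in subst id (⊨-[1]^ ξ k (¬' p) a b) (ξ⊨theory _ (¬p-after k)) p-at-k

mainTheorem1 : ∃[ T ] (FinitelySatisfiable T × ¬ Satisfiable T)
mainTheorem1 = theory , finitelySatisfiable , unsatisfiable
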